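{- Let $m\in\mathbb{Z}^+$ and $i_1,\dots,i_m\in\mathbb{N}$. There exist integers $B_{i_{1},\ldots,i_{m}}^{(\ell)}$ ($0\le \ell\le i_1+\cdots+i_m$), independent of $k$, such that for all $k\in\mathbb{N}$ \[ \prod_{j=1}^{m}\binom{k+i_{j}}{2i_{j}}\binom{2i_{j}}{i_{j}}=\sum_{\ell=0}^{i_{1}+\cdots+i_{m}}B_{i_{1},\ldots,i_{m}}^{(\ell)}\binom{k+\ell}{2\ell}\binom{2\ell}{\ell}. \] -}

module Defs where

open import Data.Nat using (ℕ; _+_)
open import Data.Nat.Combinatorics using (_C_)
open import Data.Integer as ℤ using (ℤ; +_)
open import Data.Fin using (Fin; toℕ)
open import Data.Vec using (Vec; []; _∷_)

c : ℕ → ℕ → ℕ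
c k i = ((k + i) C (i + i)) Data.Nat.* ((i + i) C i)

prodC : ∀ {m} → ℕ → Vec ℕ m → ℕ
prodC k [] = 1
prodC k (i ∷ is) = c k i Data.Nat.* prodC k is

sumV : ∀ {m} → Vec ℕ m → ℕ
sumV [] = 0
sumV (i ∷ is) = i + sumV is

sumFin : (n : ℕ) → (Fin n → ℤ) → ℤ
sumFin ℕ.zero f = + 0
sumFin (ℕ.suc n) f = f Fin.zero ℤ.+ sumFin n (λ j → f (Fin.suc j))

-- Write c k l = C(k+l, 2l) C(2l, l) = (k+l)! / ((k-l)! l!²).  Comparing consecutive terms gives
-- (l+1)² c k (l+1) = μ k l c k l with μ k l = k(k+1) - l(l+1), and from this recurrence an
-- induction on j proves the product formula
--   c k i · c k j = Σ_{s ≤ i} τ i j s · c k (j+s),   τ i j s = C(i+j, i) C(j+s, i) C(i, s):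
-- multiply by (j+1)², apply the recurrence to every c k (j+s) after splitting
-- μ k j = μ k (j+s) + s(2j+s+1), and recombine the coefficients by a Pascal-type recurrence for τ.
-- The coefficients τ are integers independent of k, so multiplying an expansion Σ_{l ≤ N} a l · c k l
-- by c k i gives an expansion of length i + N, and induction over the factors proves the theorem.

module Submission where

open import Defs
open import Data.Nat using (ℕ; zero; suc; _≤_; _<_; _≤′_; ≤′-refl; ≤′-step; s≤s)
import Data.Nat as ℕ
import Data.Nat.Properties as ℕ
import Data.Nat.Tactic.RingSolver as ℕ-Solver
open import Data.Nat.Combinatorics
  using (_C_; nCk+nC[k+1]≡[n+1]C[k+1]; nC1≡n; nCn≡1; k>n⇒nCk≡0)
open import Data.Integer using (ℤ; +_; _+_; _*_; _-_)
import Data.Integer.Properties as ℤ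
open import Data.Integer.Tactic.RingSolver using (solve-∀)
open import Data.Fin using (Fin; toℕ)
open import Data.Vec using (Vec; []; _∷_)
open import Data.Product using (Σ; ∃; _,_; map₂)
open import Data.Fin.Properties using (toℕ<n; toℕ-inject₁; toℕ-fromℕ)
open import Function using (_∘_)
open import Relation.Binary.PropositionalEquality
open import Algebra.Properties.Semiring.Sum ℤ.+-*-semiring
  using (sum; sum-cong-≗; sum-replicate-zero; sum-init-last; ∑-distrib-+; ∑-comm; *-distribˡ-sum; *-distribʳ-sum)
open import Algebra.Properties.CommutativeSemigroup ℤ.*-commutativeSemigroup
  using (x∙yz≈y∙xz; xy∙z≈y∙xz)

[k+1]*[n+1]C[k+1]≡[n+1]*nCk : ∀ n k → suc k ℕ.* (suc n C suc k) ≡ suc n ℕ.* (n C k)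
[k+1]*[n+1]C[k+1]≡[n+1]*nCk n       zero    =
  trans (ℕ.+-identityʳ (suc n C 1)) (trans (nC1≡n (suc n)) (sym (ℕ.*-identityʳ (suc n))))
[k+1]*[n+1]C[k+1]≡[n+1]*nCk zero    (suc k) = ℕ.*-zeroʳ (suc (suc k))
[k+1]*[n+1]C[k+1]≡[n+1]*nCk (suc n) (suc k) = begin
  (2 ℕ.+ k) ℕ.* (suc (suc n) C suc (suc k))
    ≡⟨ cong ((2 ℕ.+ k) ℕ.*_) (nCk+nC[k+1]≡[n+1]C[k+1] (suc n) (suc k)) ⟨
  (2 ℕ.+ k) ℕ.* (a ℕ.+ b)
    ≡⟨ split k a b ⟩
  (1 ℕ.+ k) ℕ.* a ℕ.+ (2 ℕ.+ k) ℕ.* b ℕ.+ a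
    ≡⟨ cong₂ (λ x y → x ℕ.+ y ℕ.+ a) ([k+1]*[n+1]C[k+1]≡[n+1]*nCk n k) ([k+1]*[n+1]C[k+1]≡[n+1]*nCk n (suc k)) ⟩
  suc n ℕ.* (n C k) ℕ.+ suc n ℕ.* (n C suc k) ℕ.+ a
    ≡⟨ cong (ℕ._+ a) (ℕ.*-distribˡ-+ (suc n) (n C k) (n C suc k)) ⟨
  suc n ℕ.* (n C k ℕ.+ n C suc k) ℕ.+ a
    ≡⟨ cong (λ x → suc n ℕ.* x ℕ.+ a) (nCk+nC[k+1]≡[n+1]C[k+1] n k) ⟩
  suc n ℕ.* a ℕ.+ a
    ≡⟨ ℕ.+-comm (suc n ℕ.* a) a ⟩
  (2 ℕ.+ n) ℕ.* a
    ∎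
  where
  open ≡-Reasoning
  a b : ℕ
  a = suc n C suc k
  b = suc n C suc (suc k)
  split : ∀ k a b → (2 ℕ.+ k) ℕ.* (a ℕ.+ b) ≡ (1 ℕ.+ k) ℕ.* a ℕ.+ (2 ℕ.+ k) ℕ.* b ℕ.+ a
  split = ℕ-Solver.solve-∀

infixl 8 _Cᶻ_

_Cᶻ_ : ℕ → ℕ → ℤ
n Cᶻ k = + (n C k)

pascal : ∀ n k → suc n Cᶻ suc k ≡ n Cᶻ k + n Cᶻ suc k
pascal n k = trans (cong +_ (sym (nCk+nC[k+1]≡[n+1]C[k+1] n k))) (ℤ.pos-+ (n C k) (n C suc k))

absorption : ∀ n k → + suc k * suc n Cᶻ suc k ≡ + suc n * n Cᶻ k
absorption n k = begin
  + suc k * suc n Cᶻ suc k         ≡⟨ ℤ.pos-* (suc k) (suc n C suc k) ⟨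
  + (suc k ℕ.* (suc n C suc k))    ≡⟨ cong +_ ([k+1]*[n+1]C[k+1]≡[n+1]*nCk n k) ⟩
  + (suc n ℕ.* (n C k))            ≡⟨ ℤ.pos-* (suc n) (n C k) ⟩
  + suc n * n Cᶻ k                 ∎
  where open ≡-Reasoning

[k+1]*nC[k+1]≡[n-k]*nCk : ∀ n k → + suc k * n Cᶻ suc k ≡ (+ n - + k) * n Cᶻ k
[k+1]*nC[k+1]≡[n-k]*nCk n k = begin
  + suc k * n Cᶻ suc k                                ≡⟨ isolate (+ k) (n Cᶻ k) (n Cᶻ suc k) ⟩
  + suc k * (n Cᶻ k + n Cᶻ suc k) - + suc k * n Cᶻ k  ≡⟨ cong (λ x → + suc k * x - + suc k * n Cᶻ k) (pascal n k) ⟨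
  + suc k * suc n Cᶻ suc k - + suc k * n Cᶻ k         ≡⟨ cong (_- + suc k * n Cᶻ k) (absorption n k) ⟩
  + suc n * n Cᶻ k - + suc k * n Cᶻ k                 ≡⟨ collect (+ n) (+ k) (n Cᶻ k) ⟩
  (+ n - + k) * n Cᶻ k                                ∎
  where
  open ≡-Reasoning
  isolate : ∀ k a b → (+ 1 + k) * b ≡ (+ 1 + k) * (a + b) - (+ 1 + k) * a
  isolate = solve-∀
  collect : ∀ n k a → (+ 1 + n) * a - (+ 1 + k) * a ≡ (n - k) * a
  collect = solve-∀

[n+1-k]*[n+1]Ck≡[n+1]*nCk : ∀ n k → (+ suc n - + k) * suc n Cᶻ k ≡ + suc n * n Cᶻ k
[n+1-k]*[n+1]Ck≡[n+1]*nCk n zero    = cong (_* + 1) (ℤ.+-identityʳ (+ suc n))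
[n+1-k]*[n+1]Ck≡[n+1]*nCk n (suc k) = begin
  (+ suc n - + suc k) * suc n Cᶻ suc k                          ≡⟨ distrib (+ suc n) (+ suc k) (suc n Cᶻ suc k) ⟩
  + suc n * suc n Cᶻ suc k - + suc k * suc n Cᶻ suc k            ≡⟨ cong₂ (λ x y → + suc n * x - y) (pascal n k) (absorption n k) ⟩
  + suc n * (n Cᶻ k + n Cᶻ suc k) - + suc n * n Cᶻ k             ≡⟨ cancel (+ suc n) (n Cᶻ k) (n Cᶻ suc k) ⟩
  + suc n * n Cᶻ suc k                                           ∎
  where
  open ≡-Reasoning
  distrib : ∀ n k a → (n - k) * a ≡ n * a - k * a
  distrib = solve-∀
  cancel : ∀ n a b → n * (a + b) - n * a ≡ n * b
  cancel = solve-∀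

[k+1][n+1-k]*[n+2]C[k+1]≡[n+2][n+1]*nCk : ∀ n k →
  + suc k * (+ suc n - + k) * suc (suc n) Cᶻ suc k ≡ + suc (suc n) * + suc n * n Cᶻ k
[k+1][n+1-k]*[n+2]C[k+1]≡[n+2][n+1]*nCk n k = begin
  + suc k * (+ suc n - + k) * suc (suc n) Cᶻ suc k    ≡⟨ xy∙z≈y∙xz (+ suc k) (+ suc n - + k) (suc (suc n) Cᶻ suc k) ⟩
  (+ suc n - + k) * (+ suc k * suc (suc n) Cᶻ suc k)  ≡⟨ cong ((+ suc n - + k) *_) (absorption (suc n) k) ⟩
  (+ suc n - + k) * (+ suc (suc n) * suc n Cᶻ k)      ≡⟨ x∙yz≈y∙xz (+ suc n - + k) (+ suc (suc n)) (suc n Cᶻ k) ⟩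
  + suc (suc n) * ((+ suc n - + k) * suc n Cᶻ k)      ≡⟨ cong (+ suc (suc n) *_) ([n+1-k]*[n+1]Ck≡[n+1]*nCk n k) ⟩
  + suc (suc n) * (+ suc n * n Cᶻ k)                  ≡⟨ ℤ.*-assoc (+ suc (suc n)) (+ suc n) (n Cᶻ k) ⟨
  + suc (suc n) * + suc n * n Cᶻ k                    ∎
  where open ≡-Reasoning

[m+1][m+2]*[n+1]C[m+2]≡[n+1][n-m]*nCm : ∀ n m →
  + suc m * + suc (suc m) * suc n Cᶻ suc (suc m) ≡ + suc n * (+ n - + m) * n Cᶻ m
[m+1][m+2]*[n+1]C[m+2]≡[n+1][n-m]*nCm n m = begin
  + suc m * + suc (suc m) * suc n Cᶻ suc (suc m)    ≡⟨ ℤ.*-assoc (+ suc m) (+ suc (suc m)) (suc n Cᶻ suc (suc m)) ⟩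
  + suc m * (+ suc (suc m) * suc n Cᶻ suc (suc m))  ≡⟨ cong (+ suc m *_) (absorption n (suc m)) ⟩
  + suc m * (+ suc n * n Cᶻ suc m)                  ≡⟨ x∙yz≈y∙xz (+ suc m) (+ suc n) (n Cᶻ suc m) ⟩
  + suc n * (+ suc m * n Cᶻ suc m)                  ≡⟨ cong (+ suc n *_) ([k+1]*nC[k+1]≡[n-k]*nCk n m) ⟩
  + suc n * ((+ n - + m) * n Cᶻ m)                  ≡⟨ ℤ.*-assoc (+ suc n) (+ n - + m) (n Cᶻ m) ⟨
  + suc n * (+ n - + m) * n Cᶻ m                    ∎
  where open ≡-Reasoning

cᶻ : ℕ → ℕ → ℤ
cᶻ k l = (k ℕ.+ l) Cᶻ (l ℕ.+ l) * (l ℕ.+ l) Cᶻ l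

-- μ k l = k(k+1) - l(l+1)
μ : ℕ → ℕ → ℤ
μ k l = (+ k - + l) * + suc (k ℕ.+ l)

c-step : ∀ k l → + suc l * + suc l * cᶻ k (suc l) ≡ μ k l * cᶻ k l
c-step k l rewrite ℕ.+-suc k l | ℕ.+-suc l l = begin
  + suc l * + suc l * (X * Y)                          ≡⟨ reassoc₁ (+ l) X Y ⟩
  X * (+ suc l * (+ suc (l ℕ.+ l) - + l) * Y)          ≡⟨ cong (X *_) ([k+1][n+1-k]*[n+2]C[k+1]≡[n+2][n+1]*nCk (l ℕ.+ l) l) ⟩
  X * (+ suc (suc (l ℕ.+ l)) * + suc (l ℕ.+ l) * W)    ≡⟨ reassoc₂ (+ l) X W ⟩
  + suc (l ℕ.+ l) * + suc (suc (l ℕ.+ l)) * X * W      ≡⟨ cong (_* W) ([m+1][m+2]*[n+1]C[m+2]≡[n+1][n-m]*nCm (k ℕ.+ l) (l ℕ.+ l)) ⟩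
  + suc (k ℕ.+ l) * (+ (k ℕ.+ l) - + (l ℕ.+ l)) * V * W ≡⟨ reassoc₃ (+ k) (+ l) V W ⟩
  μ k l * (V * W)                                      ∎
  where
  open ≡-Reasoning
  X Y V W : ℤ
  X = suc (k ℕ.+ l) Cᶻ suc (suc (l ℕ.+ l))
  Y = suc (suc (l ℕ.+ l)) Cᶻ suc l
  V = (k ℕ.+ l) Cᶻ (l ℕ.+ l)
  W = (l ℕ.+ l) Cᶻ l
  reassoc₁ : ∀ l x y → (+ 1 + l) * (+ 1 + l) * (x * y) ≡ x * ((+ 1 + l) * ((+ 1 + (l + l)) - l) * y)
  reassoc₁ = solve-∀
  reassoc₂ : ∀ l x w → x * ((+ 2 + (l + l)) * (+ 1 + (l + l)) * w) ≡ (+ 1 + (l + l)) * (+ 2 + (l + l)) * x * w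
  reassoc₂ = solve-∀
  reassoc₃ : ∀ k l v w → (+ 1 + (k + l)) * ((k + l) - (l + l)) * v * w ≡ (k - l) * (+ 1 + (k + l)) * (v * w)
  reassoc₃ = solve-∀

∑< : ℕ → (ℕ → ℤ) → ℤ
∑< n f = sum {n} (λ t → f (toℕ t))

∑<-cong : ∀ n {f g : ℕ → ℤ} → (∀ t → t < n → f t ≡ g t) → ∑< n f ≡ ∑< n g
∑<-cong n f≡g = sum-cong-≗ {n} (λ t → f≡g (toℕ t) (toℕ<n t))

∑<-+ : ∀ n (f g : ℕ → ℤ) → ∑< n (λ t → f t + g t) ≡ ∑< n f + ∑< n g
∑<-+ n f g = ∑-distrib-+ {n} (f ∘ toℕ) (g ∘ toℕ)

*-distribˡ-∑< : ∀ n a (f : ℕ → ℤ) → a * ∑< n f ≡ ∑< n (λ t → a * f t)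
*-distribˡ-∑< n a f = *-distribˡ-sum {n} a (f ∘ toℕ)

*-distribʳ-∑< : ∀ n a (f : ℕ → ℤ) → ∑< n f * a ≡ ∑< n (λ t → f t * a)
*-distribʳ-∑< n a f = *-distribʳ-sum {n} a (f ∘ toℕ)

∑<-comm : ∀ m n (f : ℕ → ℕ → ℤ) → ∑< m (λ s → ∑< n (f s)) ≡ ∑< n (λ t → ∑< m (λ s → f s t))
∑<-comm m n f = ∑-comm {m} {n} (λ s t → f (toℕ s) (toℕ t))

∑<-suc : ∀ n f → ∑< (suc n) f ≡ ∑< n f + f n
∑<-suc n f = trans (sum-init-last {n} (λ t → f (toℕ t)))
  (cong₂ _+_ (sum-cong-≗ {n} (λ t → cong f (toℕ-inject₁ t))) (cong f (toℕ-fromℕ n)))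

∑<-vanishing : ∀ n f → (∀ t → t < n → f t ≡ + 0) → ∑< n f ≡ + 0
∑<-vanishing n f f≡0 = trans (∑<-cong n f≡0) (sum-replicate-zero n)

∑<-slide : ∀ n f → f 0 ≡ + 0 → f (suc n) ≡ + 0 → ∑< (suc n) f ≡ ∑< (suc n) (f ∘ suc)
∑<-slide n f f₀≡0 fₙ≡0 = begin
  f 0 + ∑< n (f ∘ suc)           ≡⟨ cong (_+ ∑< n (f ∘ suc)) f₀≡0 ⟩
  + 0 + ∑< n (f ∘ suc)           ≡⟨ ℤ.+-identityˡ _ ⟩
  ∑< n (f ∘ suc)                 ≡⟨ ℤ.+-identityʳ _ ⟨
  ∑< n (f ∘ suc) + + 0           ≡⟨ cong (λ x → ∑< n (f ∘ suc) + x) fₙ≡0 ⟨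
  ∑< n (f ∘ suc) + f (suc n)     ≡⟨ ∑<-suc n (f ∘ suc) ⟨
  ∑< (suc n) (f ∘ suc)           ∎
  where open ≡-Reasoning

∑<-extend : ∀ {n m} f → n ≤ m → (∀ t → n ≤ t → f t ≡ + 0) → ∑< m f ≡ ∑< n f
∑<-extend {n} f n≤m f≡0 = go (ℕ.≤⇒≤′ n≤m)
  where
  go : ∀ {m} → n ≤′ m → ∑< m f ≡ ∑< n f
  go ≤′-refl = refl
  go (≤′-step {m} n≤′m) = begin
    ∑< (suc m) f    ≡⟨ ∑<-suc m f ⟩
    ∑< m f + f m    ≡⟨ cong₂ _+_ (go n≤′m) (f≡0 m (ℕ.≤′⇒≤ n≤′m)) ⟩
    ∑< n f + + 0    ≡⟨ ℤ.+-identityʳ _ ⟩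
    ∑< n f          ∎
    where open ≡-Reasoning

shift : ℕ → (ℕ → ℤ) → ℕ → ℤ
shift zero    g t       = g t
shift (suc l) g zero    = + 0
shift (suc l) g (suc t) = shift l g t

shift-vanishing : ∀ l {n} g → (∀ u → n ≤ u → g u ≡ + 0) → ∀ t → l ℕ.+ n ≤ t → shift l g t ≡ + 0
shift-vanishing zero    g g≡0 t       n≤t       = g≡0 t n≤t
shift-vanishing (suc l) g g≡0 (suc t) (s≤s l+n≤t) = shift-vanishing l g g≡0 t l+n≤t

∑<-shift : ∀ l m (g F : ℕ → ℤ) →
  ∑< m (λ s → g s * F (l ℕ.+ s)) ≡ ∑< (l ℕ.+ m) (λ t → shift l g t * F t)
∑<-shift zero    m g F = refl
∑<-shift (suc l) m g F = trans (∑<-shift l m g (F ∘ suc))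
  (sym (ℤ.+-identityˡ (∑< (l ℕ.+ m) (λ t → shift l g t * F (suc t)))))

τ : ℕ → ℕ → ℕ → ℤ
τ i j s = (i ℕ.+ j) Cᶻ i * (j ℕ.+ s) Cᶻ i * i Cᶻ s

-- β j s = μ k j - μ k (j + s) for every k
β : ℕ → ℕ → ℤ
β j s = + s * + suc (j ℕ.+ j ℕ.+ s)

τ-vanishing : ∀ i j s → i < s → τ i j s ≡ + 0
τ-vanishing i j s i<s rewrite k>n⇒nCk≡0 i<s = ℤ.*-zeroʳ ((i ℕ.+ j) Cᶻ i * (j ℕ.+ s) Cᶻ i)

τ-base-vanishing : ∀ i s → s < i → τ i 0 s ≡ + 0
τ-base-vanishing i s s<i =
  trans (cong (λ x → (i ℕ.+ 0) Cᶻ i * + x * i Cᶻ s) (k>n⇒nCk≡0 s<i))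
        (cong (_* i Cᶻ s) (ℤ.*-zeroʳ ((i ℕ.+ 0) Cᶻ i)))

τ-base-diagonal : ∀ i → τ i 0 i ≡ + 1
τ-base-diagonal i rewrite ℕ.+-identityʳ i | nCn≡1 i = refl

τ-step : ∀ i j s →
  + suc j * + suc j * τ i (suc j) s
    ≡ + suc (j ℕ.+ s) * + suc (j ℕ.+ s) * τ i j s + β j (suc s) * τ i j (suc s)
τ-step i j s rewrite ℕ.+-suc i j | ℕ.+-suc j s = begin
  + suc j * + suc j * (P′ * R′ * S)
    ≡⟨ isolate-P′ (+ i) (+ j) P′ R′ S ⟩
  + suc j * R′ * S * ((+ suc (i ℕ.+ j) - + i) * P′)
    ≡⟨ cong (+ suc j * R′ * S *_) ([n+1-k]*[n+1]Ck≡[n+1]*nCk (i ℕ.+ j) i) ⟩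
  + suc j * R′ * S * (+ suc (i ℕ.+ j) * P)
    ≡⟨ split-coefficient (+ i) (+ j) (+ s) P R′ S ⟩
  + suc (j ℕ.+ s) * P * S * ((+ suc (j ℕ.+ s) - + i) * R′) + + suc (j ℕ.+ j ℕ.+ suc s) * P * R′ * ((+ i - + s) * S)
    ≡⟨ cong₂ (λ x y → + suc (j ℕ.+ s) * P * S * x + + suc (j ℕ.+ j ℕ.+ suc s) * P * R′ * y)
             ([n+1-k]*[n+1]Ck≡[n+1]*nCk (j ℕ.+ s) i) (sym ([k+1]*nC[k+1]≡[n-k]*nCk i s)) ⟩
  + suc (j ℕ.+ s) * P * S * (+ suc (j ℕ.+ s) * R) + + suc (j ℕ.+ j ℕ.+ suc s) * P * R′ * (+ suc s * S′)
    ≡⟨ regroup (+ j) (+ s) P R R′ S S′ ⟩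
  + suc (j ℕ.+ s) * + suc (j ℕ.+ s) * (P * R * S) + β j (suc s) * (P * R′ * S′)
    ∎
  where
  open ≡-Reasoning
  P P′ R R′ S S′ : ℤ
  P  = (i ℕ.+ j) Cᶻ i
  P′ = suc (i ℕ.+ j) Cᶻ i
  R  = (j ℕ.+ s) Cᶻ i
  R′ = suc (j ℕ.+ s) Cᶻ i
  S  = i Cᶻ s
  S′ = i Cᶻ suc s
  isolate-P′ : ∀ i j p′ r′ s →
    (+ 1 + j) * (+ 1 + j) * (p′ * r′ * s) ≡ (+ 1 + j) * r′ * s * ((+ 1 + (i + j) - i) * p′)
  isolate-P′ = solve-∀
  split-coefficient : ∀ i j s p r′ σ →
    (+ 1 + j) * r′ * σ * ((+ 1 + (i + j)) * p)
      ≡ (+ 1 + (j + s)) * p * σ * ((+ 1 + (j + s) - i) * r′)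
        + (+ 1 + (j + j + (+ 1 + s))) * p * r′ * ((i - s) * σ)
  split-coefficient = solve-∀
  regroup : ∀ j s p r r′ σ σ′ →
    (+ 1 + (j + s)) * p * σ * ((+ 1 + (j + s)) * r) + (+ 1 + (j + j + (+ 1 + s))) * p * r′ * ((+ 1 + s) * σ′)
      ≡ (+ 1 + (j + s)) * (+ 1 + (j + s)) * (p * r * σ) + (+ 1 + s) * (+ 1 + (j + j + (+ 1 + s))) * (p * r′ * σ′)
  regroup = solve-∀

μ*c-split : ∀ k j s →
  μ k j * cᶻ k (j ℕ.+ s) ≡ + suc (j ℕ.+ s) * + suc (j ℕ.+ s) * cᶻ k (suc (j ℕ.+ s)) + β j s * cᶻ k (j ℕ.+ s)
μ*c-split k j s = begin
  μ k j * cᶻ k (j ℕ.+ s)                                  ≡⟨ cong (_* cᶻ k (j ℕ.+ s)) (μ-split (+ k) (+ j) (+ s)) ⟩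
  (μ k (j ℕ.+ s) + β j s) * cᶻ k (j ℕ.+ s)                ≡⟨ ℤ.*-distribʳ-+ (cᶻ k (j ℕ.+ s)) (μ k (j ℕ.+ s)) (β j s) ⟩
  μ k (j ℕ.+ s) * cᶻ k (j ℕ.+ s) + β j s * cᶻ k (j ℕ.+ s) ≡⟨ cong (_+ β j s * cᶻ k (j ℕ.+ s)) (c-step k (j ℕ.+ s)) ⟨
  + suc (j ℕ.+ s) * + suc (j ℕ.+ s) * cᶻ k (suc (j ℕ.+ s)) + β j s * cᶻ k (j ℕ.+ s) ∎
  where
  open ≡-Reasoning
  μ-split : ∀ k j s →
    (k - j) * (+ 1 + (k + j)) ≡ (k - (j + s)) * (+ 1 + (k + (j + s))) + s * (+ 1 + (j + j + s))
  μ-split = solve-∀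

μ*τ-expansion : ∀ i j k →
  μ k j * ∑< (suc i) (λ s → τ i j s * cᶻ k (j ℕ.+ s))
    ≡ + suc j * + suc j * ∑< (suc i) (λ s → τ i (suc j) s * cᶻ k (suc j ℕ.+ s))
μ*τ-expansion i j k = begin
  μ k j * ∑< (suc i) (λ s → τ i j s * cᶻ k (j ℕ.+ s))
    ≡⟨ *-distribˡ-∑< (suc i) (μ k j) (λ s → τ i j s * cᶻ k (j ℕ.+ s)) ⟩
  ∑< (suc i) (λ s → μ k j * (τ i j s * cᶻ k (j ℕ.+ s)))
    ≡⟨ ∑<-cong (suc i) (λ s _ → split s) ⟩
  ∑< (suc i) (λ s → raised s + kept s)
    ≡⟨ ∑<-+ (suc i) raised kept ⟩
  ∑< (suc i) raised + ∑< (suc i) kept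
    ≡⟨ cong (λ x → ∑< (suc i) raised + x) (∑<-slide i kept kept₀≡0 keptᵢ₊₁≡0) ⟩
  ∑< (suc i) raised + ∑< (suc i) (kept ∘ suc)
    ≡⟨ ∑<-+ (suc i) raised (kept ∘ suc) ⟨
  ∑< (suc i) (λ s → raised s + kept (suc s))
    ≡⟨ ∑<-cong (suc i) (λ s _ → recombine s) ⟩
  ∑< (suc i) (λ s → q * (τ i (suc j) s * cᶻ k (suc j ℕ.+ s)))
    ≡⟨ *-distribˡ-∑< (suc i) q (λ s → τ i (suc j) s * cᶻ k (suc j ℕ.+ s)) ⟨
  q * ∑< (suc i) (λ s → τ i (suc j) s * cᶻ k (suc j ℕ.+ s))
    ∎
  where
  open ≡-Reasoning
  q : ℤ
  q = + suc j * + suc j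
  raised kept : ℕ → ℤ
  raised s = τ i j s * (+ suc (j ℕ.+ s) * + suc (j ℕ.+ s) * cᶻ k (suc (j ℕ.+ s)))
  kept   s = τ i j s * (β j s * cᶻ k (j ℕ.+ s))
  split : ∀ s → μ k j * (τ i j s * cᶻ k (j ℕ.+ s)) ≡ raised s + kept s
  split s = trans (x∙yz≈y∙xz (μ k j) (τ i j s) (cᶻ k (j ℕ.+ s)))
                  (trans (cong (τ i j s *_) (μ*c-split k j s)) (ℤ.*-distribˡ-+ (τ i j s) _ _))
  kept₀≡0 : kept 0 ≡ + 0
  kept₀≡0 = ℤ.*-zeroʳ (τ i j 0)
  keptᵢ₊₁≡0 : kept (suc i) ≡ + 0
  keptᵢ₊₁≡0 = cong (_* (β j (suc i) * cᶻ k (j ℕ.+ suc i))) (τ-vanishing i j (suc i) (ℕ.n<1+n i))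
  recombine : ∀ s → raised s + kept (suc s) ≡ q * (τ i (suc j) s * cᶻ k (suc j ℕ.+ s))
  recombine s = begin
    raised s + kept (suc s)
      ≡⟨ cong (λ n → raised s + τ i j (suc s) * (β j (suc s) * cᶻ k n)) (ℕ.+-suc j s) ⟩
    raised s + τ i j (suc s) * (β j (suc s) * c′)
      ≡⟨ factor (τ i j s) (+ suc (j ℕ.+ s) * + suc (j ℕ.+ s)) (τ i j (suc s)) (β j (suc s)) c′ ⟩
    (+ suc (j ℕ.+ s) * + suc (j ℕ.+ s) * τ i j s + β j (suc s) * τ i j (suc s)) * c′
      ≡⟨ cong (_* c′) (τ-step i j s) ⟨
    q * τ i (suc j) s * c′
      ≡⟨ ℤ.*-assoc q (τ i (suc j) s) c′ ⟩
    q * (τ i (suc j) s * c′)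
      ∎
    where
    c′ : ℤ
    c′ = cᶻ k (suc (j ℕ.+ s))
    factor : ∀ t w t′ b c → t * (w * c) + t′ * (b * c) ≡ (w * t + b * t′) * c
    factor = solve-∀

c*c-expansion : ∀ i j k → cᶻ k i * cᶻ k j ≡ ∑< (suc i) (λ s → τ i j s * cᶻ k (j ℕ.+ s))
c*c-expansion i zero k = begin
  cᶻ k i * + 1                                   ≡⟨ ℤ.*-identityʳ (cᶻ k i) ⟩
  cᶻ k i                                         ≡⟨ trans (ℤ.+-identityˡ (+ 1 * cᶻ k i)) (ℤ.*-identityˡ (cᶻ k i)) ⟨
  + 0 + + 1 * cᶻ k i                             ≡⟨ cong₂ _+_ (∑<-vanishing i f (λ s s<i → cong (_* cᶻ k s) (τ-base-vanishing i s s<i)))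
                                                              (cong (_* cᶻ k i) (τ-base-diagonal i)) ⟨
  ∑< i f + f i                                   ≡⟨ ∑<-suc i f ⟨
  ∑< (suc i) f                                   ∎
  where
  open ≡-Reasoning
  f : ℕ → ℤ
  f s = τ i 0 s * cᶻ k s
c*c-expansion i (suc j) k = ℤ.*-cancelˡ-≡ q _ _ (begin
  q * (cᶻ k i * cᶻ k (suc j))  ≡⟨ x∙yz≈y∙xz q (cᶻ k i) (cᶻ k (suc j)) ⟩
  cᶻ k i * (q * cᶻ k (suc j))  ≡⟨ cong (cᶻ k i *_) (c-step k j) ⟩
  cᶻ k i * (μ k j * cᶻ k j)    ≡⟨ x∙yz≈y∙xz (cᶻ k i) (μ k j) (cᶻ k j) ⟩
  μ k j * (cᶻ k i * cᶻ k j)    ≡⟨ cong (μ k j *_) (c*c-expansion i j k) ⟩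
  μ k j * ∑< (suc i) (λ s → τ i j s * cᶻ k (j ℕ.+ s))
    ≡⟨ μ*τ-expansion i j k ⟩
  q * ∑< (suc i) (λ s → τ i (suc j) s * cᶻ k (suc j ℕ.+ s))
    ∎)
  where
  open ≡-Reasoning
  q : ℤ
  q = + suc j * + suc j

Expansion : ℕ → (ℕ → ℤ) → Set
Expansion N F = Σ (ℕ → ℤ) λ a → ∀ k → F k ≡ ∑< (suc N) (λ l → a l * cᶻ k l)

c*c-expansion-≤ : ∀ i {l N} → l ≤ N → ∀ k →
  cᶻ k i * cᶻ k l ≡ ∑< (suc (i ℕ.+ N)) (λ t → shift l (τ i l) t * cᶻ k t)
c*c-expansion-≤ i {l} {N} l≤N k = begin
  cᶻ k i * cᶻ k l                                         ≡⟨ c*c-expansion i l k ⟩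
  ∑< (suc i) (λ s → τ i l s * cᶻ k (l ℕ.+ s))             ≡⟨ ∑<-shift l (suc i) (τ i l) (cᶻ k) ⟩
  ∑< (l ℕ.+ suc i) (λ t → shift l (τ i l) t * cᶻ k t)     ≡⟨ ∑<-extend _ bound vanishing ⟨
  ∑< (suc (i ℕ.+ N)) (λ t → shift l (τ i l) t * cᶻ k t)   ∎
  where
  open ≡-Reasoning
  bound : l ℕ.+ suc i ≤ suc (i ℕ.+ N)
  bound = ℕ.≤-Reasoning.begin
    l ℕ.+ suc i   ℕ.≤-Reasoning.≡⟨ ℕ.+-suc l i ⟩
    suc (l ℕ.+ i) ℕ.≤-Reasoning.≤⟨ s≤s (ℕ.+-monoˡ-≤ i l≤N) ⟩
    suc (N ℕ.+ i) ℕ.≤-Reasoning.≡⟨ cong suc (ℕ.+-comm N i) ⟩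
    suc (i ℕ.+ N) ℕ.≤-Reasoning.∎
  vanishing : ∀ t → l ℕ.+ suc i ≤ t → shift l (τ i l) t * cᶻ k t ≡ + 0
  vanishing t le = cong (_* cᶻ k t) (shift-vanishing l (τ i l) (τ-vanishing i l) t le)

c*-expansion : ∀ i {N F} → Expansion N F → Expansion (i ℕ.+ N) (λ k → cᶻ k i * F k)
c*-expansion i {N} {F} (a , F≡∑) = b , λ k → begin
  cᶻ k i * F k                                           ≡⟨ cong (cᶻ k i *_) (F≡∑ k) ⟩
  cᶻ k i * ∑< (suc N) (λ l → a l * cᶻ k l)               ≡⟨ *-distribˡ-∑< (suc N) (cᶻ k i) (λ l → a l * cᶻ k l) ⟩
  ∑< (suc N) (λ l → cᶻ k i * (a l * cᶻ k l))             ≡⟨ ∑<-cong (suc N) (λ l l≤N → expand k l (ℕ.≤-pred l≤N)) ⟩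
  ∑< (suc N) (λ l → ∑< M (λ t → a l * (d l t * cᶻ k t))) ≡⟨ ∑<-comm (suc N) M (λ l t → a l * (d l t * cᶻ k t)) ⟩
  ∑< M (λ t → ∑< (suc N) (λ l → a l * (d l t * cᶻ k t))) ≡⟨ ∑<-cong M (λ t _ → collect k t) ⟩
  ∑< M (λ t → b t * cᶻ k t)                              ∎
  where
  open ≡-Reasoning
  M : ℕ
  M = suc (i ℕ.+ N)
  d : ℕ → ℕ → ℤ
  d l = shift l (τ i l)
  b : ℕ → ℤ
  b t = ∑< (suc N) (λ l → a l * d l t)
  expand : ∀ k l → l ≤ N → cᶻ k i * (a l * cᶻ k l) ≡ ∑< M (λ t → a l * (d l t * cᶻ k t))
  expand k l l≤N = begin
    cᶻ k i * (a l * cᶻ k l)                ≡⟨ x∙yz≈y∙xz (cᶻ k i) (a l) (cᶻ k l) ⟩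
    a l * (cᶻ k i * cᶻ k l)                ≡⟨ cong (a l *_) (c*c-expansion-≤ i l≤N k) ⟩
    a l * ∑< M (λ t → d l t * cᶻ k t)      ≡⟨ *-distribˡ-∑< M (a l) (λ t → d l t * cᶻ k t) ⟩
    ∑< M (λ t → a l * (d l t * cᶻ k t))    ∎
  collect : ∀ k t → ∑< (suc N) (λ l → a l * (d l t * cᶻ k t)) ≡ b t * cᶻ k t
  collect k t = begin
    ∑< (suc N) (λ l → a l * (d l t * cᶻ k t)) ≡⟨ ∑<-cong (suc N) (λ l _ → ℤ.*-assoc (a l) (d l t) (cᶻ k t)) ⟨
    ∑< (suc N) (λ l → a l * d l t * cᶻ k t)   ≡⟨ *-distribʳ-∑< (suc N) (cᶻ k t) (λ l → a l * d l t) ⟨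
    b t * cᶻ k t                              ∎

+c≡cᶻ : ∀ k l → + c k l ≡ cᶻ k l
+c≡cᶻ k l = ℤ.pos-* ((k ℕ.+ l) C (l ℕ.+ l)) ((l ℕ.+ l) C l)

prodC-expansion : ∀ {m} (is : Vec ℕ m) → Expansion (sumV is) (λ k → + prodC k is)
prodC-expansion []       = (λ _ → + 1) , λ k → refl
prodC-expansion (i ∷ is) = map₂ (λ F≡∑ k → trans (+prodC≡ k) (F≡∑ k)) (c*-expansion i (prodC-expansion is))
  where
  +prodC≡ : ∀ k → + prodC k (i ∷ is) ≡ cᶻ k i * + prodC k is
  +prodC≡ k = trans (ℤ.pos-* (c k i) (prodC k is)) (cong (_* + prodC k is) (+c≡cᶻ k i))

sumFin≡sum : ∀ n (f : Fin n → ℤ) → sumFin n f ≡ sum f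
sumFin≡sum zero    f = refl
sumFin≡sum (suc n) f = cong (λ x → f Fin.zero + x) (sumFin≡sum n (f ∘ Fin.suc))

lemma2p6 : (m : ℕ) → 1 ≤ m → (is : Vec ℕ m) →
    ∃ λ (B : Fin (ℕ.suc (sumV is)) → ℤ) →
    (k : ℕ) → + (prodC k is) ≡ sumFin (ℕ.suc (sumV is)) (λ ℓ → B ℓ * + (c k (toℕ ℓ)))
lemma2p6 _ _ is with prodC-expansion is
... | a , F≡∑ = a ∘ toℕ , λ k → begin
  + prodC k is                                      ≡⟨ F≡∑ k ⟩
  ∑< (suc N) (λ l → a l * cᶻ k l)                   ≡⟨ ∑<-cong (suc N) (λ l _ → cong (a l *_) (+c≡cᶻ k l)) ⟨
  ∑< (suc N) (λ l → a l * + c k l)                  ≡⟨ sumFin≡sum (suc N) (λ ℓ → a (toℕ ℓ) * + c k (toℕ ℓ)) ⟨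
  sumFin (suc N) (λ ℓ → a (toℕ ℓ) * + c k (toℕ ℓ)) ∎
  where
  open ≡-Reasoning
  N : ℕ
  N = sumV is
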